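{- A finite connected graph of diameter $2$ is Bonnet–Myers sharp if and only if it is a cocktail party graph $CP(m)$ for some $m\ge 2$. (Stated in the paper as: the only Bonnet–Myers sharp graphs of diameter $2$ are the cocktail party graphs $CP(m)$ with $m\ge 2$.)
   Context: For a graph with vertices $v_1,\dots,v_n$, $D=(d(v_i,v_j))_{i,j}$ is its distance matrix and $\mathbf 1_n$ the all-ones column vector. When $DK=n\mathbf 1_n$ has solutions, the Steinerberger curvature vector is a solution $K$ maximizing $\min_iK_i$. $G$ is Bonnet–Myers sharp if $DK=n\mathbf 1_n$ has a solution and the Steinerberger curvature vector satisfies $\min_iK_i=2/\mathrm{diam}(G)$. The cocktail party graph $CP(m)$ is the complete graph $K_{2m}$ with a perfect matching removed.
   Formalization: The solutions K of $DK=n\mathbf 1_n$, including the Steinerberger curvature vector, have rational entries. -}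

module Defs where

open import Data.Nat as ℕ using (ℕ; zero; suc; _≤_; NonZero)
open import Data.Nat.DivMod using (_/_)
open import Data.Fin using (Fin; toℕ)
open import Data.Bool using (Bool; true; false; not; _∧_)
open import Data.Integer using (+_)
open import Data.Rational as ℚ using (ℚ)
open import Data.Product using (Σ; ∃; ∃-syntax; _×_; _,_)
open import Function.Bundles using (_↔_; Inverse)
open import Relation.Binary.PropositionalEquality using (_≡_)
open import Relation.Nullary using (¬_)
open import Relation.Nullary.Decidable using (⌊_⌋)

record Graph (n : ℕ) : Set where
  field
    adj     : Fin n → Fin n → Bool
    adj-sym : ∀ u v → adj u v ≡ adj v u
    adj-irr : ∀ u → adj u u ≡ false
open Graph public

data Walk {n : ℕ} (G : Graph n) : Fin n → Fin n → ℕ → Set where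
  here : ∀ {u} → Walk G u u 0
  step : ∀ {u v w k} → adj G u v ≡ true → Walk G v w k → Walk G u w (suc k)

IsDist : ∀ {n} → Graph n → Fin n → Fin n → ℕ → Set
IsDist G u v k = Walk G u v k × (∀ j → Walk G u v j → k ≤ j)

-- D is the distance matrix of G (in particular G is connected).
IsDistanceMatrix : ∀ {n} → Graph n → (Fin n → Fin n → ℕ) → Set
IsDistanceMatrix {n} G D = ∀ u v → IsDist G u v (D u v)

HasDiameter : ∀ {n} → (Fin n → Fin n → ℕ) → ℕ → Set
HasDiameter {n} D d = (∀ u v → D u v ≤ d) × (∃[ u ] ∃[ v ] D u v ≡ d)

sumℚ : ∀ {n} → (Fin n → ℚ) → ℚ
sumℚ {zero}  f = ℚ.0ℚ
sumℚ {suc n} f = f Data.Fin.zero ℚ.+ sumℚ (λ i → f (Data.Fin.suc i))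

ℕtoℚ : ℕ → ℚ
ℕtoℚ k = (+ k) ℚ./ 1

SolvesCurv : ∀ {n} → (Fin n → Fin n → ℕ) → (Fin n → ℚ) → Set
SolvesCurv {n} D K = ∀ i → sumℚ (λ j → ℕtoℚ (D i j) ℚ.* K j) ≡ ℕtoℚ n

-- Bonnet–Myers sharp (diameter d): D K = n 1 is solvable and the maximum,
-- over solutions K, of min_i K_i exists and equals 2/d.
BonnetMyersSharp : ∀ {n} → (Fin n → Fin n → ℕ) → (d : ℕ) → .{{NonZero d}} → Set
BonnetMyersSharp {n} D d =
  (∃[ K ] (SolvesCurv D K × (∀ i → (+ 2) ℚ./ d ℚ.≤ K i)))
  × (∀ K → SolvesCurv D K → ∃[ i ] K i ℚ.≤ (+ 2) ℚ./ d)

-- Cocktail party graph CP(m) on Fin (2m): vertices 2k and 2k+1 form the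
-- removed perfect matching; every other pair of distinct vertices is adjacent.
cpAdj : (m : ℕ) → Fin (2 ℕ.* m) → Fin (2 ℕ.* m) → Bool
cpAdj m u v = not ⌊ toℕ u ℕ.≟ toℕ v ⌋ ∧ not ⌊ (toℕ u / 2) ℕ.≟ (toℕ v / 2) ⌋

IsoTo : ∀ {n k} → Graph n → (Fin k → Fin k → Bool) → Set
IsoTo {n} {k} G a =
  Σ (Fin n ↔ Fin k) λ f → ∀ u v → adj G u v ≡ a (Inverse.to f u) (Inverse.to f v)

IsCocktailParty : ∀ {n} → Graph n → ℕ → Set
IsCocktailParty G m = IsoTo G (cpAdj m)

-- In a graph of diameter 2 the distance matrix is D = 2(J − I) − A, so D + I = J + N, where N
-- is the adjacency matrix of the complement without loops. A solution of DK = n·1 therefore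
-- satisfies n + K u = ΣK + (NK) u at every vertex u. Sharpness gives a solution with K ≥ 2/2 = 1;
-- then (NK) u ≥ K v and (NK) v ≥ K u for a pair u, v at distance 2, and adding the two rows yields
-- ΣK ≤ n ≤ ΣK. Hence K = 1 and N·1 = 1: every vertex has exactly one non-neighbour, which makes
-- G a cocktail party graph (with m ≥ 2 because some pair is at distance 2). Conversely, in CP(m)
-- the matrix N is the permutation matrix of the removed matching σ, so K = 1 is a solution, and
-- the rows of u and σ u force ΣK ≤ n for every solution, hence some K i ≤ 1.
-- The isomorphism with CP(m) is built by induction on n, conjugating the matching by a
-- transposition so that it swaps the vertices 0 and 1.

module Submission where

open import Defs
open import Data.Nat as ℕ using (ℕ; zero; suc; _≤_; _<_; ⌊_/2⌋; z≤n; s≤s; z<s; s<s)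
import Data.Nat.Properties as ℕP
open import Data.Nat.DivMod using (_/_; m/n≡1+[m∸n]/n)
import Data.Nat.Coprimality as Cop
import Data.Integer as ℤ
import Data.Integer.Properties as ℤP
open import Data.Fin as F using (Fin; zero; suc; toℕ; fromℕ<)
open import Data.Fin.Patterns using (0F; 1F)
import Data.Fin.Properties as FP
open import Data.Fin.Permutation as P
  using (Permutation; Permutation′; _⟨$⟩ʳ_; _⟨$⟩ˡ_; _∘ₚ_; lift₀; transpose; cast-id)
import Data.Fin.Permutation.Components as PC
open import Data.Bool using (Bool; true; false; not; _∧_)
open import Data.Bool.Properties using (∧-zeroʳ)
open import Data.Product using (∃-syntax; _×_; _,_; proj₁; proj₂)
open import Data.Sum as Sum using (_⊎_; inj₁; inj₂)
open import Data.Empty using (⊥-elim)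
open import Data.Rational as ℚ using (ℚ; 0ℚ; 1ℚ; _+_; _*_; -_)
import Data.Rational.Properties as QP
open import Algebra.Bundles using (CommutativeMonoid)
open import Algebra.Properties.CommutativeSemigroup (CommutativeMonoid.commutativeSemigroup QP.+-0-commutativeMonoid)
  using () renaming (interchange to +-interchange)
open import Algebra.Properties.Group QP.+-0-group using (//-rightDividesʳ; ∙-cancelˡ; ∙-cancelʳ)
open import Function.Base using (_∘_)
open import Function.Bundles using (_⇔_; mk⇔; Equivalence)
open import Function.Construct.Composition using (_⇔-∘_)
open import Function.Construct.Symmetry using (⇔-sym)
open import Relation.Nullary using (Dec; yes; no; does; contradiction)
open import Relation.Nullary.Decidable using (dec-true; dec-false; ⌊_⌋)
open import Relation.Binary.PropositionalEquality

-- Parity and the pairing 2k ↔ 2k + 1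

-- The perfect matching removed in cpAdj pairs 2k with 2k + 1.
mate : ℕ → ℕ
mate 0 = 1
mate 1 = 0
mate (suc (suc k)) = suc (suc (mate k))

mate-≢ : ∀ k → mate k ≢ k
mate-≢ (suc (suc k)) e = mate-≢ k (ℕP.suc-injective (ℕP.suc-injective e))

⌊mate/2⌋≡⌊/2⌋ : ∀ k → ⌊ mate k /2⌋ ≡ ⌊ k /2⌋
⌊mate/2⌋≡⌊/2⌋ 0 = refl
⌊mate/2⌋≡⌊/2⌋ 1 = refl
⌊mate/2⌋≡⌊/2⌋ (suc (suc k)) = cong suc (⌊mate/2⌋≡⌊/2⌋ k)

⌊/2⌋-fibre : ∀ x y → ⌊ x /2⌋ ≡ ⌊ y /2⌋ → y ≡ x ⊎ y ≡ mate x
⌊/2⌋-fibre 0 0 _ = inj₁ refl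
⌊/2⌋-fibre 0 1 _ = inj₂ refl
⌊/2⌋-fibre 1 0 _ = inj₂ refl
⌊/2⌋-fibre 1 1 _ = inj₁ refl
⌊/2⌋-fibre (suc (suc x)) (suc (suc y)) e =
  Sum.map (cong (λ z → suc (suc z))) (cong (λ z → suc (suc z)))
    (⌊/2⌋-fibre x y (ℕP.suc-injective e))

⌊n/2⌋≡n/2 : ∀ n → ⌊ n /2⌋ ≡ n / 2
⌊n/2⌋≡n/2 0 = refl
⌊n/2⌋≡n/2 1 = refl
⌊n/2⌋≡n/2 (suc (suc n)) =
  trans (cong suc (⌊n/2⌋≡n/2 n)) (sym (m/n≡1+[m∸n]/n {suc (suc n)} {2} (s≤s (s≤s z≤n))))

mate-< : ∀ {k} m → k < 2 ℕ.* m → mate k < 2 ℕ.* m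
mate-< {0}           (suc m) _         rewrite ℕP.+-suc m (m ℕ.+ 0) = s≤s (s≤s z≤n)
mate-< {1}           (suc m) _         = z<s
mate-< {suc (suc k)} (suc m) (s<s k<) rewrite ℕP.+-suc m (m ℕ.+ 0) =
  s<s (s<s (mate-< m (ℕP.≤-pred k<)))

3≤m+m⇒2≤m : ∀ m → 3 ≤ m ℕ.+ m → 2 ≤ m
3≤m+m⇒2≤m (suc (suc m)) _ = s≤s (s≤s z≤n)
3≤m+m⇒2≤m 1 (s≤s (s≤s ()))

/2≡/2⇔≡∨mate : ∀ x y → x / 2 ≡ y / 2 ⇔ (y ≡ x ⊎ y ≡ mate x)
/2≡/2⇔≡∨mate x y = mk⇔ to from
  where
  to : x / 2 ≡ y / 2 → y ≡ x ⊎ y ≡ mate x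
  to e = ⌊/2⌋-fibre x y (trans (⌊n/2⌋≡n/2 x) (trans e (sym (⌊n/2⌋≡n/2 y))))
  from : y ≡ x ⊎ y ≡ mate x → x / 2 ≡ y / 2
  from (inj₁ refl) = refl
  from (inj₂ refl) = trans (sym (⌊n/2⌋≡n/2 x)) (trans (sym (⌊mate/2⌋≡⌊/2⌋ x)) (⌊n/2⌋≡n/2 (mate x)))

-- Fixed-point-free involutions of Fin n

transpose-matchˡ : ∀ {n} (i j : Fin n) → PC.transpose i j i ≡ j
transpose-matchˡ i j rewrite dec-true (i FP.≟ i) refl = refl

transpose-fixed : ∀ {n} {i j k : Fin n} → k ≢ i → k ≢ j → PC.transpose i j k ≡ k
transpose-fixed {i = i} {j} {k} k≢i k≢j
  rewrite dec-false (k FP.≟ i) k≢i | dec-false (k FP.≟ j) k≢j = refl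

pred₂ : ∀ {n} (x : Fin (suc (suc n))) → x ≢ 0F → x ≢ 1F → Fin n
pred₂ 0F            x≢0 _   = contradiction refl x≢0
pred₂ 1F            _   x≢1 = contradiction refl x≢1
pred₂ (suc (suc x)) _   _   = x

suc-suc-pred₂ : ∀ {n} (x : Fin (suc (suc n))) x≢0 x≢1 → suc (suc (pred₂ x x≢0 x≢1)) ≡ x
suc-suc-pred₂ 0F            x≢0 _   = contradiction refl x≢0
suc-suc-pred₂ 1F            _   x≢1 = contradiction refl x≢1
suc-suc-pred₂ (suc (suc x)) _   _   = refl

record FixedPointFreeInvolution (n : ℕ) : Set where
  field
    σ : Fin n → Fin n
    σ-≢ : ∀ i → σ i ≢ i
    σ-involutive : ∀ i → σ (σ i) ≡ i

open FixedPointFreeInvolution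

σ-injective : ∀ {n} (ι : FixedPointFreeInvolution n) {i j} → σ ι i ≡ σ ι j → i ≡ j
σ-injective ι {i} {j} e = trans (sym (σ-involutive ι i)) (trans (cong (σ ι) e) (σ-involutive ι j))

σ-swap : ∀ {n} (ι : FixedPointFreeInvolution n) {i j} → σ ι i ≡ j → σ ι j ≡ i
σ-swap ι {i} e = trans (cong (σ ι) (sym e)) (σ-involutive ι i)

record Pairing {n} (ι : FixedPointFreeInvolution n) : Set where
  field
    m : ℕ
    n≡m+m : n ≡ m ℕ.+ m
    π : Permutation′ n
    π-σ : ∀ i → toℕ (π ⟨$⟩ʳ σ ι i) ≡ mate (toℕ (π ⟨$⟩ʳ i))

conjugate : ∀ {n} → Permutation′ n → FixedPointFreeInvolution n → FixedPointFreeInvolution n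
conjugate ρ ι = record
  { σ = σ′
  ; σ-≢ = λ i e → σ-≢ ι (ρ ⟨$⟩ʳ i) (trans (sym (P.inverseʳ ρ)) (cong (ρ ⟨$⟩ʳ_) e))
  ; σ-involutive = λ i → begin
      ρ ⟨$⟩ˡ σ ι (ρ ⟨$⟩ʳ (ρ ⟨$⟩ˡ σ ι (ρ ⟨$⟩ʳ i))) ≡⟨ cong (λ x → ρ ⟨$⟩ˡ σ ι x) (P.inverseʳ ρ) ⟩
      ρ ⟨$⟩ˡ σ ι (σ ι (ρ ⟨$⟩ʳ i))                 ≡⟨ cong (ρ ⟨$⟩ˡ_) (σ-involutive ι _) ⟩
      ρ ⟨$⟩ˡ (ρ ⟨$⟩ʳ i)                          ≡⟨ P.inverseˡ ρ ⟩
      i                                          ∎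
  }
  where
  open ≡-Reasoning
  σ′ : Fin _ → Fin _
  σ′ i = ρ ⟨$⟩ˡ σ ι (ρ ⟨$⟩ʳ i)

pairing-conjugate : ∀ {n} ρ (ι : FixedPointFreeInvolution n) → Pairing (conjugate ρ ι) → Pairing ι
pairing-conjugate ρ ι p = record
  { m = m ; n≡m+m = n≡m+m ; π = P.flip ρ ∘ₚ π
  ; π-σ = λ i → begin
      toℕ (π ⟨$⟩ʳ (ρ ⟨$⟩ˡ σ ι i))
        ≡⟨ cong (λ x → toℕ (π ⟨$⟩ʳ (ρ ⟨$⟩ˡ σ ι x))) (P.inverseʳ ρ) ⟨
      toℕ (π ⟨$⟩ʳ (ρ ⟨$⟩ˡ σ ι (ρ ⟨$⟩ʳ (ρ ⟨$⟩ˡ i))))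
        ≡⟨ π-σ (ρ ⟨$⟩ˡ i) ⟩
      mate (toℕ (π ⟨$⟩ʳ (ρ ⟨$⟩ˡ i)))
        ∎
  }
  where
  open Pairing p
  open ≡-Reasoning

module _ {n} (ι : FixedPointFreeInvolution (suc (suc n))) (σ0≡1 : σ ι 0F ≡ 1F) where

  private
    σ-ss≢0 : ∀ y → σ ι (suc (suc y)) ≢ 0F
    σ-ss≢0 y e = contradiction (σ-injective ι (trans e (sym (σ-swap ι σ0≡1)))) λ ()

    σ-ss≢1 : ∀ y → σ ι (suc (suc y)) ≢ 1F
    σ-ss≢1 y e = contradiction (σ-injective ι (trans e (sym σ0≡1))) λ ()

    σ′ : Fin n → Fin n
    σ′ y = pred₂ (σ ι (suc (suc y))) (σ-ss≢0 y) (σ-ss≢1 y)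

    σ′-lift : ∀ y → suc (suc (σ′ y)) ≡ σ ι (suc (suc y))
    σ′-lift y = suc-suc-pred₂ _ (σ-ss≢0 y) (σ-ss≢1 y)

  restrict : FixedPointFreeInvolution n
  restrict = record
    { σ = σ′
    ; σ-≢ = λ y e → σ-≢ ι (suc (suc y)) (trans (sym (σ′-lift y)) (cong (λ x → suc (suc x)) e))
    ; σ-involutive = λ y → FP.suc-injective (FP.suc-injective (begin
        suc (suc (σ′ (σ′ y)))      ≡⟨ σ′-lift (σ′ y) ⟩
        σ ι (suc (suc (σ′ y)))     ≡⟨ cong (σ ι) (σ′-lift y) ⟩
        σ ι (σ ι (suc (suc y)))    ≡⟨ σ-involutive ι _ ⟩
        suc (suc y)                ∎))
    }
    where open ≡-Reasoning

  pairing-restrict : Pairing restrict → Pairing ι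
  pairing-restrict p = record
    { m = suc m
    ; n≡m+m = cong suc (trans (cong suc n≡m+m) (sym (ℕP.+-suc m m)))
    ; π = π′
    ; π-σ = π′-σ
    }
    where
    open Pairing p
    π′ : Permutation′ (suc (suc n))
    π′ = lift₀ (lift₀ π)
    π′-σ : ∀ i → toℕ (π′ ⟨$⟩ʳ σ ι i) ≡ mate (toℕ (π′ ⟨$⟩ʳ i))
    π′-σ 0F            = cong (λ x → toℕ (π′ ⟨$⟩ʳ x)) σ0≡1
    π′-σ 1F            = cong (λ x → toℕ (π′ ⟨$⟩ʳ x)) (σ-swap ι σ0≡1)
    π′-σ (suc (suc y)) = trans (cong (λ x → toℕ (π′ ⟨$⟩ʳ x)) (sym (σ′-lift y)))
                               (cong (λ k → suc (suc k)) (π-σ y))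

pairing : ∀ {n} (ι : FixedPointFreeInvolution n) → Pairing ι
pairing {0} ι = record { m = 0 ; n≡m+m = refl ; π = P.id ; π-σ = λ () }
pairing {1} ι with σ ι 0F in e
... | 0F = contradiction e (σ-≢ ι 0F)
pairing {suc (suc n)} ι =
  pairing-conjugate τ ι (pairing-restrict ι′ ι′0≡1 (pairing (restrict ι′ ι′0≡1)))
  where
  a : Fin (suc (suc n))
  a = σ ι 0F
  τ : Permutation′ (suc (suc n))
  τ = transpose 1F a
  ι′ : FixedPointFreeInvolution (suc (suc n))
  ι′ = conjugate τ ι
  ι′0≡1 : σ ι′ 0F ≡ 1F
  ι′0≡1 rewrite transpose-fixed {i = 1F} {j = a} {k = 0F} (λ ()) (λ e → σ-≢ ι 0F (sym e)) =
    transpose-matchˡ a 1F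

-- Cocktail party graphs are the graphs with a perfect non-neighbour matching

≡false⇔⇒≡ : ∀ {a b : Bool} → (a ≡ false ⇔ b ≡ false) → a ≡ b
≡false⇔⇒≡ {false} a⇔b = sym (Equivalence.to a⇔b refl)
≡false⇔⇒≡ {true}  {false} a⇔b with () ← Equivalence.from a⇔b refl
≡false⇔⇒≡ {true}  {true}  _ = refl

not∧not≡false⇔ : ∀ {a b} {A : Set a} {B : Set b} → (A → B) → (A? : Dec A) (B? : Dec B) →
                 (not ⌊ A? ⌋ ∧ not ⌊ B? ⌋ ≡ false) ⇔ B
not∧not≡false⇔ _   _       (yes b) = mk⇔ (λ _ → b) (λ _ → ∧-zeroʳ _)
not∧not≡false⇔ A⇒B (yes a) (no ¬b) = contradiction (A⇒B a) ¬b
not∧not≡false⇔ _   (no _)  (no ¬b) = mk⇔ (λ ()) (λ b → contradiction b ¬b)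

cpAdj≡false⇔ : ∀ m (x y : Fin (2 ℕ.* m)) →
               cpAdj m x y ≡ false ⇔ (toℕ y ≡ toℕ x ⊎ toℕ y ≡ mate (toℕ x))
cpAdj≡false⇔ m x y = /2≡/2⇔≡∨mate (toℕ x) (toℕ y)
  ⇔-∘ not∧not≡false⇔ (cong (_/ 2)) (toℕ x ℕ.≟ toℕ y) ((toℕ x / 2) ℕ.≟ (toℕ y / 2))

record NonNeighbourMatching {n} (G : Graph n) : Set where
  field
    partner        : Fin n → Fin n
    partner-≢      : ∀ u → partner u ≢ u
    nonadjacent⇔   : ∀ u v → adj G u v ≡ false ⇔ (v ≡ u ⊎ v ≡ partner u)

  partner-nonadjacent : ∀ u → adj G u (partner u) ≡ false
  partner-nonadjacent u = Equivalence.from (nonadjacent⇔ u (partner u)) (inj₂ refl)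

  partner-involutive : ∀ u → partner (partner u) ≡ u
  partner-involutive u with Equivalence.to (nonadjacent⇔ (partner u) u)
                              (trans (adj-sym G (partner u) u) (partner-nonadjacent u))
  ... | inj₁ u≡pu  = contradiction (sym u≡pu) (partner-≢ u)
  ... | inj₂ u≡ppu = sym u≡ppu

  fixedPointFreeInvolution : FixedPointFreeInvolution n
  fixedPointFreeInvolution = record
    { σ = partner ; σ-≢ = partner-≢ ; σ-involutive = partner-involutive }

≡∨σ⇔≡∨mate : ∀ {n} {g : Fin n → ℕ} (σ : Fin n → Fin n) {u v} → (∀ {x y} → g x ≡ g y → x ≡ y) →
             g (σ u) ≡ mate (g u) → (v ≡ u ⊎ v ≡ σ u) ⇔ (g v ≡ g u ⊎ g v ≡ mate (g u))
≡∨σ⇔≡∨mate {g = g} σ {u} {v} g-injective gσu≡mate = mk⇔ to from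
  where
  to : v ≡ u ⊎ v ≡ σ u → g v ≡ g u ⊎ g v ≡ mate (g u)
  to (inj₁ refl) = inj₁ refl
  to (inj₂ refl) = inj₂ gσu≡mate
  from : g v ≡ g u ⊎ g v ≡ mate (g u) → v ≡ u ⊎ v ≡ σ u
  from (inj₁ gv≡gu)   = inj₁ (g-injective gv≡gu)
  from (inj₂ gv≡mate) = inj₂ (g-injective (trans gv≡mate (sym gσu≡mate)))

toℕ∘permutation-injective : ∀ {m n} (f : Permutation m n) {x y} →
                             toℕ (f ⟨$⟩ʳ x) ≡ toℕ (f ⟨$⟩ʳ y) → x ≡ y
toℕ∘permutation-injective f {x} {y} fx≡fy =
  trans (sym (P.inverseˡ f)) (trans (cong (f ⟨$⟩ˡ_) (FP.toℕ-injective fx≡fy)) (P.inverseˡ f))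

mateFin : ∀ m → Fin (2 ℕ.* m) → Fin (2 ℕ.* m)
mateFin m x = fromℕ< (mate-< m (FP.toℕ<n x))

toℕ-mateFin : ∀ m (x : Fin (2 ℕ.* m)) → toℕ (mateFin m x) ≡ mate (toℕ x)
toℕ-mateFin m x = FP.toℕ-fromℕ< (mate-< m (FP.toℕ<n x))

cocktailParty⇒nonNeighbourMatching : ∀ {n} {G : Graph n} m → IsCocktailParty G m → NonNeighbourMatching G
cocktailParty⇒nonNeighbourMatching {n} {G} m (f , adj≡cpAdj) = record
  { partner      = partner
  ; partner-≢    = λ u pu≡u → mate-≢ (g u) (trans (sym (g-partner u)) (cong g pu≡u))
  ; nonadjacent⇔ = λ u v →
      ⇔-sym (≡∨σ⇔≡∨mate partner (toℕ∘permutation-injective f) (g-partner u))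
        ⇔-∘ subst (λ b → (b ≡ false) ⇔ _) (sym (adj≡cpAdj u v)) (cpAdj≡false⇔ m (f ⟨$⟩ʳ u) (f ⟨$⟩ʳ v))
  }
  where
  partner : Fin n → Fin n
  partner u = f ⟨$⟩ˡ mateFin m (f ⟨$⟩ʳ u)
  g : Fin n → ℕ
  g u = toℕ (f ⟨$⟩ʳ u)
  g-partner : ∀ u → g (partner u) ≡ mate (g u)
  g-partner u = trans (cong toℕ (P.inverseʳ f)) (toℕ-mateFin m (f ⟨$⟩ʳ u))

nonNeighbourMatching⇒cocktailParty : ∀ {n} {G : Graph n} → 3 ≤ n → NonNeighbourMatching G →
                                     ∃[ m ] (2 ≤ m × IsCocktailParty G m)
nonNeighbourMatching⇒cocktailParty {n} {G} 3≤n M =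
  m , 3≤m+m⇒2≤m m (subst (3 ≤_) n≡m+m 3≤n) , f , adj≡cpAdj
  where
  open NonNeighbourMatching M
  open Pairing (pairing fixedPointFreeInvolution)
  n≡2m : n ≡ 2 ℕ.* m
  n≡2m = trans n≡m+m (cong (m ℕ.+_) (sym (ℕP.+-identityʳ m)))
  f : Permutation n (2 ℕ.* m)
  f = π ∘ₚ cast-id n≡2m
  g : Fin n → ℕ
  g u = toℕ (f ⟨$⟩ʳ u)
  g≡π : ∀ u → g u ≡ toℕ (π ⟨$⟩ʳ u)
  g≡π u = FP.toℕ-cast n≡2m (π ⟨$⟩ʳ u)
  g-partner : ∀ u → g (partner u) ≡ mate (g u)
  g-partner u = trans (g≡π (partner u)) (trans (π-σ u) (cong mate (sym (g≡π u))))
  adj≡cpAdj : ∀ u v → adj G u v ≡ cpAdj m (f ⟨$⟩ʳ u) (f ⟨$⟩ʳ v)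
  adj≡cpAdj u v = ≡false⇔⇒≡
    (⇔-sym (cpAdj≡false⇔ m (f ⟨$⟩ʳ u) (f ⟨$⟩ʳ v))
      ⇔-∘ (≡∨σ⇔≡∨mate partner (toℕ∘permutation-injective f) (g-partner u) ⇔-∘ nonadjacent⇔ u v))

nonNeighbourᵇ : ∀ {n} → Graph n → Fin n → Fin n → Bool
nonNeighbourᵇ G u v = not (does (u F.≟ v)) ∧ not (adj G u v)

nonNeighbourᵇ≡true : ∀ {n} (G : Graph n) {u v} → u ≢ v → adj G u v ≡ false → nonNeighbourᵇ G u v ≡ true
nonNeighbourᵇ≡true G {u} {v} u≢v uv rewrite dec-false (u F.≟ v) u≢v | uv = refl

nonNeighbourᵇ≡true⁻¹ : ∀ {n} (G : Graph n) {u v} → nonNeighbourᵇ G u v ≡ true → u ≢ v × adj G u v ≡ false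
nonNeighbourᵇ≡true⁻¹ G {u} {v} e with u F.≟ v | adj G u v
... | no u≢v | false = u≢v , refl

uniqueNonNeighbours⇒matching : ∀ {n} {G : Graph n} →
  (∀ u → ∃[ a ] (nonNeighbourᵇ G u a ≡ true × ∀ b → nonNeighbourᵇ G u b ≡ true → b ≡ a)) →
  NonNeighbourMatching G
uniqueNonNeighbours⇒matching {G = G} unique = record
  { partner      = partner
  ; partner-≢    = λ u → ≢-sym (proj₁ (nonNeighbourᵇ≡true⁻¹ G (partner-nonNeighbour u)))
  ; nonadjacent⇔ = λ u v → mk⇔ (to u v) (from u v)
  }
  where
  partner : Fin _ → Fin _
  partner u = proj₁ (unique u)
  partner-nonNeighbour : ∀ u → nonNeighbourᵇ G u (partner u) ≡ true
  partner-nonNeighbour u = proj₁ (proj₂ (unique u))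
  to : ∀ u v → adj G u v ≡ false → v ≡ u ⊎ v ≡ partner u
  to u v uv with v F.≟ u
  ... | yes v≡u = inj₁ v≡u
  ... | no  v≢u = inj₂ (proj₂ (proj₂ (unique u)) v (nonNeighbourᵇ≡true G (≢-sym v≢u) uv))
  from : ∀ u v → v ≡ u ⊎ v ≡ partner u → adj G u v ≡ false
  from u v (inj₁ refl) = adj-irr G u
  from u v (inj₂ refl) = proj₂ (nonNeighbourᵇ≡true⁻¹ G (partner-nonNeighbour u))

module _ {n} {G : Graph n} (M : NonNeighbourMatching G) where
  open NonNeighbourMatching M

  nonNeighbourᵇ≡partner : ∀ u v → nonNeighbourᵇ G u v ≡ does (partner u F.≟ v)
  nonNeighbourᵇ≡partner u v with partner u F.≟ v
  ... | yes refl = nonNeighbourᵇ≡true G (≢-sym (partner-≢ u)) (partner-nonadjacent u)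
  ... | no pu≢v with nonNeighbourᵇ G u v in e
  ...   | false = refl
  ...   | true with Equivalence.to (nonadjacent⇔ u v) (proj₂ (nonNeighbourᵇ≡true⁻¹ G e))
  ...     | inj₁ v≡u  = contradiction (sym v≡u) (proj₁ (nonNeighbourᵇ≡true⁻¹ G e))
  ...     | inj₂ v≡pu = contradiction (sym v≡pu) pu≢v

-- Finite sums of rationals

𝟙 : Bool → ℚ
𝟙 true  = 1ℚ
𝟙 false = 0ℚ

0≤𝟙 : ∀ b → 0ℚ ℚ.≤ 𝟙 b
0≤𝟙 true  = QP.nonNegative⁻¹ 1ℚ
0≤𝟙 false = QP.≤-refl

ℕtoℚ-suc : ∀ k → ℕtoℚ (suc k) ≡ 1ℚ + ℕtoℚ k
ℕtoℚ-suc k rewrite QP.normalize-coprime (Cop.sym (Cop.1-coprimeTo k)) =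
  cong (λ z → z ℚ./ 1) (cong (λ w → ℤ.+ 1 ℤ.+ w) (sym (ℤP.*-identityʳ (ℤ.+ k))))

+-cancelʳ-≤ : ∀ {a b} c → a + c ℚ.≤ b + c → a ℚ.≤ b
+-cancelʳ-≤ {a} {b} c a+c≤b+c =
  subst₂ ℚ._≤_ (//-rightDividesʳ c a) (//-rightDividesʳ c b) (QP.+-monoˡ-≤ (- c) a+c≤b+c)

+-cancelˡ-≤ : ∀ c {a b} → c + a ℚ.≤ c + b → a ℚ.≤ b
+-cancelˡ-≤ c {a} {b} c+a≤c+b = +-cancelʳ-≤ c (subst₂ ℚ._≤_ (QP.+-comm c a) (QP.+-comm c b) c+a≤c+b)

sumℚ-cong : ∀ {n} {f g : Fin n → ℚ} → (∀ j → f j ≡ g j) → sumℚ f ≡ sumℚ g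
sumℚ-cong {zero}  _   = refl
sumℚ-cong {suc n} f≗g = cong₂ _+_ (f≗g zero) (sumℚ-cong (f≗g ∘ suc))

sumℚ-+ : ∀ {n} (f g : Fin n → ℚ) → sumℚ (λ j → f j + g j) ≡ sumℚ f + sumℚ g
sumℚ-+ {zero}  _ _ = refl
sumℚ-+ {suc n} f g = begin
  (f zero + g zero) + sumℚ (λ j → f (suc j) + g (suc j))
    ≡⟨ cong ((f zero + g zero) +_) (sumℚ-+ (f ∘ suc) (g ∘ suc)) ⟩
  (f zero + g zero) + (sumℚ (f ∘ suc) + sumℚ (g ∘ suc))
    ≡⟨ +-interchange (f zero) (g zero) _ _ ⟩
  (f zero + sumℚ (f ∘ suc)) + (g zero + sumℚ (g ∘ suc))
    ∎
  where open ≡-Reasoning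

sumℚ-mono-≤ : ∀ {n} {f g : Fin n → ℚ} → (∀ j → f j ℚ.≤ g j) → sumℚ f ℚ.≤ sumℚ g
sumℚ-mono-≤ {zero}  _   = QP.≤-refl
sumℚ-mono-≤ {suc n} f≤g = QP.+-mono-≤ (f≤g zero) (sumℚ-mono-≤ (f≤g ∘ suc))

sumℚ-1 : ∀ n → sumℚ {n} (λ _ → 1ℚ) ≡ ℕtoℚ n
sumℚ-1 zero    = refl
sumℚ-1 (suc n) = trans (cong (1ℚ +_) (sumℚ-1 n)) (sym (ℕtoℚ-suc n))

δ : ∀ {n} → Fin n → Fin n → ℚ
δ i j = 𝟙 (does (i F.≟ j))

sumℚ-0 : ∀ n → sumℚ {n} (λ _ → 0ℚ) ≡ 0ℚ
sumℚ-0 zero    = refl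
sumℚ-0 (suc n) = cong (0ℚ +_) (sumℚ-0 n)

sumℚ-δ : ∀ {n} (i : Fin n) (f : Fin n → ℚ) → sumℚ (λ j → δ i j * f j) ≡ f i
sumℚ-δ {suc n} zero f = begin
  1ℚ * f zero + sumℚ (λ j → 0ℚ * f (suc j))
    ≡⟨ cong₂ _+_ (QP.*-identityˡ (f zero)) (sumℚ-cong (QP.*-zeroˡ ∘ f ∘ suc)) ⟩
  f zero + sumℚ {n} (λ _ → 0ℚ)              ≡⟨ cong (f zero +_) (sumℚ-0 n) ⟩
  f zero + 0ℚ                               ≡⟨ QP.+-identityʳ (f zero) ⟩
  f zero                                    ∎
  where open ≡-Reasoning
sumℚ-δ {suc n} (suc i) f = begin
  0ℚ * f zero + sumℚ (λ j → δ i j * f (suc j))  ≡⟨ cong₂ _+_ (QP.*-zeroˡ (f zero)) (sumℚ-δ i (f ∘ suc)) ⟩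
  0ℚ + f (suc i)                                ≡⟨ QP.+-identityˡ (f (suc i)) ⟩
  f (suc i)                                     ∎
  where open ≡-Reasoning

sumℚ-nonNeg : ∀ {n} {f : Fin n → ℚ} → (∀ j → 0ℚ ℚ.≤ f j) → 0ℚ ℚ.≤ sumℚ f
sumℚ-nonNeg {n} 0≤f = QP.≤-trans (QP.≤-reflexive (sym (sumℚ-0 n))) (sumℚ-mono-≤ 0≤f)

term≤sumℚ : ∀ {n} {f : Fin n → ℚ} → (∀ j → 0ℚ ℚ.≤ f j) → ∀ i → f i ℚ.≤ sumℚ f
term≤sumℚ {suc n} {f} 0≤f zero = begin
  f zero           ≡⟨ QP.+-identityʳ (f zero) ⟨
  f zero + 0ℚ      ≤⟨ QP.+-monoʳ-≤ (f zero) (sumℚ-nonNeg (0≤f ∘ suc)) ⟩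
  sumℚ f           ∎
  where open QP.≤-Reasoning
term≤sumℚ {suc n} {f} 0≤f (suc i) = begin
  f (suc i)                ≤⟨ term≤sumℚ (0≤f ∘ suc) i ⟩
  sumℚ (f ∘ suc)           ≡⟨ QP.+-identityˡ _ ⟨
  0ℚ + sumℚ (f ∘ suc)      ≤⟨ QP.+-monoˡ-≤ _ (0≤f zero) ⟩
  sumℚ f                   ∎
  where open QP.≤-Reasoning

sumℚ-squeeze : ∀ {n} {f g : Fin n → ℚ} → (∀ j → f j ℚ.≤ g j) → sumℚ g ℚ.≤ sumℚ f →
               ∀ i → g i ℚ.≤ f i
sumℚ-squeeze {suc n} {f} {g} f≤g Σg≤Σf zero = +-cancelʳ-≤ (sumℚ (g ∘ suc)) (begin
  g zero + sumℚ (g ∘ suc)   ≤⟨ Σg≤Σf ⟩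
  f zero + sumℚ (f ∘ suc)   ≤⟨ QP.+-monoʳ-≤ (f zero) (sumℚ-mono-≤ (f≤g ∘ suc)) ⟩
  f zero + sumℚ (g ∘ suc)   ∎)
  where open QP.≤-Reasoning
sumℚ-squeeze {suc n} {f} {g} f≤g Σg≤Σf (suc i) = sumℚ-squeeze (f≤g ∘ suc) (+-cancelˡ-≤ (g zero) (begin
  g zero + sumℚ (g ∘ suc)   ≤⟨ Σg≤Σf ⟩
  f zero + sumℚ (f ∘ suc)   ≤⟨ QP.+-monoˡ-≤ (sumℚ (f ∘ suc)) (f≤g zero) ⟩
  g zero + sumℚ (f ∘ suc)   ∎)) i
  where open QP.≤-Reasoning

sumℚ-𝟙≡1⇒∃! : ∀ {n} (s : Fin n → Bool) → sumℚ (𝟙 ∘ s) ≡ 1ℚ →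
               ∃[ a ] (s a ≡ true × ∀ b → s b ≡ true → b ≡ a)
sumℚ-𝟙≡1⇒∃! {suc n} s Σ≡1 with s zero in s0
... | true = zero , s0 , unique
  where
  rest≡0 : sumℚ (𝟙 ∘ s ∘ suc) ≡ 0ℚ
  rest≡0 = ∙-cancelˡ 1ℚ _ _ (trans Σ≡1 (sym (QP.+-identityʳ 1ℚ)))
  unique : ∀ b → s b ≡ true → b ≡ zero
  unique zero    _   = refl
  unique (suc b) sb≡true = contradiction
    (subst₂ ℚ._≤_ (cong 𝟙 sb≡true) rest≡0 (term≤sumℚ (0≤𝟙 ∘ s ∘ suc) b))
    λ 1≤0 → QP.<-irrefl refl (QP.<-≤-trans (QP.positive⁻¹ 1ℚ) 1≤0)
... | false with sumℚ-𝟙≡1⇒∃! (s ∘ suc) (trans (sym (QP.+-identityˡ _)) Σ≡1)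
...   | a , sa , unique = suc a , sa , unique′
  where
  unique′ : ∀ b → s b ≡ true → b ≡ suc a
  unique′ zero    s0≡true = contradiction (trans (sym s0) s0≡true) λ ()
  unique′ (suc b) sb≡true = cong suc (unique b sb≡true)

0≤𝟙*nonNeg : ∀ b {x} → 0ℚ ℚ.≤ x → 0ℚ ℚ.≤ 𝟙 b * x
0≤𝟙*nonNeg true  {x} 0≤x = subst (0ℚ ℚ.≤_) (sym (QP.*-identityˡ x)) 0≤x
0≤𝟙*nonNeg false {x} _   = QP.≤-reflexive (sym (QP.*-zeroˡ x))

p+p≤q+q⇒p≤q : ∀ {p q} → p + p ℚ.≤ q + q → p ℚ.≤ q
p+p≤q+q⇒p≤q {p} {q} p+p≤q+q with p QP.≤? q
... | yes p≤q = p≤q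
... | no  p≰q = ⊥-elim (QP.<-irrefl refl (QP.≤-<-trans p+p≤q+q (QP.+-mono-< q<p q<p)))
  where
  q<p : q ℚ.< p
  q<p = QP.≰⇒> p≰q

crossed-≤ : ∀ {a b x y} → b + y ℚ.≤ a + x → b + x ℚ.≤ a + y → b ℚ.≤ a
crossed-≤ {a} {b} {x} {y} h₁ h₂ = p+p≤q+q⇒p≤q (+-cancelʳ-≤ (x + y) (begin
  (b + b) + (x + y)   ≡⟨ cong ((b + b) +_) (QP.+-comm x y) ⟩
  (b + b) + (y + x)   ≡⟨ +-interchange b y b x ⟨
  (b + y) + (b + x)   ≤⟨ QP.+-mono-≤ h₁ h₂ ⟩
  (a + x) + (a + y)   ≡⟨ +-interchange a x a y ⟩
  (a + a) + (x + y)   ∎))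
  where open QP.≤-Reasoning

-- Distances in a graph of diameter at most 2

distinct₃⇒3≤n : ∀ {n} {a b c : Fin n} → a ≢ b → b ≢ c → a ≢ c → 3 ≤ n
distinct₃⇒3≤n {suc (suc (suc n))} _ _ _ = s≤s (s≤s (s≤s z≤n))
distinct₃⇒3≤n {1} {0F} {0F}      a≢b _   _   = contradiction refl a≢b
distinct₃⇒3≤n {2} {0F} {0F}      a≢b _   _   = contradiction refl a≢b
distinct₃⇒3≤n {2} {1F} {1F}      a≢b _   _   = contradiction refl a≢b
distinct₃⇒3≤n {2} {0F} {1F} {0F} _   _   a≢c = contradiction refl a≢c
distinct₃⇒3≤n {2} {0F} {1F} {1F} _   b≢c _   = contradiction refl b≢c
distinct₃⇒3≤n {2} {1F} {0F} {0F} _   b≢c _   = contradiction refl b≢c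
distinct₃⇒3≤n {2} {1F} {0F} {1F} _   _   a≢c = contradiction refl a≢c

adjacent⇒≢ : ∀ {n} (G : Graph n) {u v} → adj G u v ≡ true → u ≢ v
adjacent⇒≢ G {u} uv refl = contradiction (trans (sym uv) (adj-irr G u)) λ ()

walk-0⇒≡ : ∀ {n} {G : Graph n} {u v} → Walk G u v 0 → u ≡ v
walk-0⇒≡ here = refl

walk-1⇒adjacent : ∀ {n} {G : Graph n} {u v} → Walk G u v 1 → adj G u v ≡ true
walk-1⇒adjacent (step uv here) = uv

module Distances {n} {G : Graph n} {D : Fin n → Fin n → ℕ} (isD : IsDistanceMatrix G D) where

  walk : ∀ u v → Walk G u v (D u v)
  walk u v = proj₁ (isD u v)

  dist-refl : ∀ u → D u u ≡ 0
  dist-refl u = ℕP.n≤0⇒n≡0 (proj₂ (isD u u) 0 here)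

  dist≡0⇒≡ : ∀ {u v} → D u v ≡ 0 → u ≡ v
  dist≡0⇒≡ {u} {v} Duv≡0 = walk-0⇒≡ (subst (Walk G u v) Duv≡0 (walk u v))

  adjacent⇒dist≡1 : ∀ {u v} → adj G u v ≡ true → D u v ≡ 1
  adjacent⇒dist≡1 {u} {v} uv with D u v in Duv | proj₂ (isD u v) 1 (step uv here)
  ... | 0 | _ = contradiction (dist≡0⇒≡ Duv) (adjacent⇒≢ G uv)
  ... | 1 | _ = refl
  ... | suc (suc _) | s≤s ()

  nonadjacent⇒dist≡2 : (∀ u v → D u v ≤ 2) → ∀ {u v} → u ≢ v → adj G u v ≡ false → D u v ≡ 2
  nonadjacent⇒dist≡2 D≤2 {u} {v} u≢v uv with D u v in Duv | D≤2 u v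
  ... | 0 | _ = contradiction (dist≡0⇒≡ Duv) u≢v
  ... | 1 | _ = contradiction (trans (sym (walk-1⇒adjacent (subst (Walk G u v) Duv (walk u v)))) uv) λ ()
  ... | 2 | _ = refl
  ... | suc (suc (suc _)) | s≤s (s≤s ())

  dist≡2⇒≢ : ∀ {u v} → D u v ≡ 2 → u ≢ v
  dist≡2⇒≢ {u} Duv≡2 refl = contradiction (trans (sym (dist-refl u)) Duv≡2) λ ()

  dist≡2⇒nonadjacent : ∀ {u v} → D u v ≡ 2 → adj G u v ≡ false
  dist≡2⇒nonadjacent {u} {v} Duv≡2 with adj G u v in uv
  ... | true  = contradiction (trans (sym (adjacent⇒dist≡1 uv)) Duv≡2) λ ()
  ... | false = refl

  dist≡2⇒3≤n : ∀ {u v} → D u v ≡ 2 → 3 ≤ n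
  dist≡2⇒3≤n {u} {v} Duv≡2 with subst (Walk G u v) Duv≡2 (walk u v)
  ... | step uw (step wv here) = distinct₃⇒3≤n (adjacent⇒≢ G uw) (adjacent⇒≢ G wv) (dist≡2⇒≢ Duv≡2)

-- The curvature equation DK = n·1

module Curvature {n} {G : Graph n} {D : Fin n → Fin n → ℕ}
                 (isD : IsDistanceMatrix G D) (D≤2 : ∀ u v → D u v ≤ 2) where
  open Distances isD

  N : Fin n → Fin n → ℚ
  N u v = 𝟙 (nonNeighbourᵇ G u v)

  DK : (Fin n → ℚ) → Fin n → ℚ
  DK K u = sumℚ (λ v → ℕtoℚ (D u v) * K v)

  NK : (Fin n → ℚ) → Fin n → ℚ
  NK K u = sumℚ (λ v → N u v * K v)

  dist+δ≡1+N : ∀ u v → ℕtoℚ (D u v) + δ u v ≡ 1ℚ + N u v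
  dist+δ≡1+N u v with u F.≟ v
  ... | yes refl rewrite dist-refl u = refl
  ... | no u≢v with adj G u v in uv
  ...   | true  rewrite adjacent⇒dist≡1 uv = refl
  ...   | false rewrite nonadjacent⇒dist≡2 D≤2 u≢v uv = refl

  row-identity : ∀ K u → DK K u + K u ≡ sumℚ K + NK K u
  row-identity K u = begin
    DK K u + K u                                    ≡⟨ cong (DK K u +_) (sumℚ-δ u K) ⟨
    DK K u + sumℚ (λ v → δ u v * K v)               ≡⟨ sumℚ-+ _ (λ v → δ u v * K v) ⟨
    sumℚ (λ v → ℕtoℚ (D u v) * K v + δ u v * K v)   ≡⟨ sumℚ-cong entry ⟩
    sumℚ (λ v → K v + N u v * K v)                  ≡⟨ sumℚ-+ K (λ v → N u v * K v) ⟩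
    sumℚ K + NK K u                                 ∎
    where
    open ≡-Reasoning
    entry : ∀ v → ℕtoℚ (D u v) * K v + δ u v * K v ≡ K v + N u v * K v
    entry v = begin
      ℕtoℚ (D u v) * K v + δ u v * K v  ≡⟨ QP.*-distribʳ-+ (K v) (ℕtoℚ (D u v)) (δ u v) ⟨
      (ℕtoℚ (D u v) + δ u v) * K v      ≡⟨ cong (_* K v) (dist+δ≡1+N u v) ⟩
      (1ℚ + N u v) * K v                ≡⟨ QP.*-distribʳ-+ (K v) 1ℚ (N u v) ⟩
      1ℚ * K v + N u v * K v            ≡⟨ cong (_+ N u v * K v) (QP.*-identityˡ (K v)) ⟩
      K v + N u v * K v                 ∎

  solution-row : ∀ {K} → SolvesCurv D K → ∀ u → ℕtoℚ n + K u ≡ sumℚ K + NK K u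
  solution-row {K} sol u = trans (cong (_+ K u) (sym (sol u))) (row-identity K u)

  sumℚ≤n : ∀ {K u v} → SolvesCurv D K → K v ℚ.≤ NK K u → K u ℚ.≤ NK K v → sumℚ K ℚ.≤ ℕtoℚ n
  sumℚ≤n {K} {u} {v} sol Kv≤ Ku≤ = crossed-≤ (row≥ u v Kv≤) (row≥ v u Ku≤)
    where
    row≥ : ∀ x y → K y ℚ.≤ NK K x → sumℚ K + K y ℚ.≤ ℕtoℚ n + K x
    row≥ x y Ky≤ = QP.≤-trans (QP.+-monoʳ-≤ (sumℚ K) Ky≤) (QP.≤-reflexive (sym (solution-row sol x)))

  nonNeighbour≤NK : ∀ {K u v} → (∀ j → 0ℚ ℚ.≤ K j) → nonNeighbourᵇ G u v ≡ true → K v ℚ.≤ NK K u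
  nonNeighbour≤NK {K} {u} {v} 0≤K uv = subst (ℚ._≤ NK K u) NuvKv≡Kv
    (term≤sumℚ (λ j → 0≤𝟙*nonNeg (nonNeighbourᵇ G u j) (0≤K j)) v)
    where
    NuvKv≡Kv : N u v * K v ≡ K v
    NuvKv≡Kv rewrite uv = QP.*-identityˡ (K v)

  ones-solution⇒matching : SolvesCurv D (λ _ → 1ℚ) → NonNeighbourMatching G
  ones-solution⇒matching sol = uniqueNonNeighbours⇒matching λ u →
    sumℚ-𝟙≡1⇒∃! (nonNeighbourᵇ G u) (sym (∙-cancelˡ (ℕtoℚ n) _ _ (begin
      ℕtoℚ n + 1ℚ
        ≡⟨ solution-row sol u ⟩
      sumℚ {n} (λ _ → 1ℚ) + NK (λ _ → 1ℚ) u
        ≡⟨ cong₂ _+_ (sumℚ-1 n) (sumℚ-cong (λ v → QP.*-identityʳ (N u v))) ⟩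
      ℕtoℚ n + sumℚ (N u)
        ∎)))
    where open ≡-Reasoning

  solution≥1⇒ones-solution : ∀ {K u v} → D u v ≡ 2 → SolvesCurv D K → (∀ i → 1ℚ ℚ.≤ K i) →
                             SolvesCurv D (λ _ → 1ℚ)
  solution≥1⇒ones-solution {K} {u} {v} Duv≡2 sol 1≤K i =
    trans (sumℚ-cong (λ j → cong (ℕtoℚ (D i j) ℚ.*_) (sym (K≡1 j)))) (sol i)
    where
    0≤K : ∀ j → 0ℚ ℚ.≤ K j
    0≤K j = QP.≤-trans (QP.nonNegative⁻¹ 1ℚ) (1≤K j)
    u≢v : u ≢ v
    u≢v = dist≡2⇒≢ Duv≡2
    uv : adj G u v ≡ false
    uv = dist≡2⇒nonadjacent Duv≡2
    ΣK≤n : sumℚ K ℚ.≤ ℕtoℚ n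
    ΣK≤n = sumℚ≤n sol (nonNeighbour≤NK 0≤K (nonNeighbourᵇ≡true G u≢v uv))
                      (nonNeighbour≤NK 0≤K (nonNeighbourᵇ≡true G (≢-sym u≢v) (trans (adj-sym G v u) uv)))
    K≡1 : ∀ j → K j ≡ 1ℚ
    K≡1 j = QP.≤-antisym (sumℚ-squeeze 1≤K (subst (sumℚ K ℚ.≤_) (sym (sumℚ-1 n)) ΣK≤n) j) (1≤K j)

  module _ (M : NonNeighbourMatching G) where
    open NonNeighbourMatching M

    NK≡partner : ∀ K u → NK K u ≡ K (partner u)
    NK≡partner K u = trans (sumℚ-cong (λ v → cong (λ b → 𝟙 b * K v) (nonNeighbourᵇ≡partner M u v)))
                           (sumℚ-δ (partner u) K)

    ones-solution : SolvesCurv D (λ _ → 1ℚ)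
    ones-solution u = ∙-cancelʳ 1ℚ _ _ (begin
      DK (λ _ → 1ℚ) u + 1ℚ                     ≡⟨ row-identity (λ _ → 1ℚ) u ⟩
      sumℚ {n} (λ _ → 1ℚ) + NK (λ _ → 1ℚ) u    ≡⟨ cong₂ _+_ (sumℚ-1 n) (NK≡partner (λ _ → 1ℚ) u) ⟩
      ℕtoℚ n + 1ℚ                              ∎)
      where open ≡-Reasoning

    solution-has-entry≤1 : Fin n → ∀ {K} → SolvesCurv D K → ∃[ i ] K i ℚ.≤ 1ℚ
    solution-has-entry≤1 u {K} sol with FP.any? (λ i → K i QP.≤? 1ℚ)
    ... | yes entry≤1 = entry≤1
    ... | no  ∄entry≤1 = u , sumℚ-squeeze 1≤K (subst (sumℚ K ℚ.≤_) (sym (sumℚ-1 n)) ΣK≤n) u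
      where
      1≤K : ∀ i → 1ℚ ℚ.≤ K i
      1≤K i = QP.<⇒≤ (QP.≰⇒> (λ Ki≤1 → ∄entry≤1 (i , Ki≤1)))
      ΣK≤n : sumℚ K ℚ.≤ ℕtoℚ n
      ΣK≤n = sumℚ≤n sol (QP.≤-reflexive (sym (NK≡partner K u)))
        (QP.≤-reflexive (trans (cong K (sym (partner-involutive u))) (sym (NK≡partner K (partner u)))))

proposition5p5 : (n : ℕ) (G : Graph n) (D : Fin n → Fin n → ℕ)
    → IsDistanceMatrix G D → HasDiameter D 2
    → (BonnetMyersSharp D 2 ⇔ (∃[ m ] (2 ≤ m × IsCocktailParty G m)))
proposition5p5 n G D isD (D≤2 , u , v , Duv≡2) = mk⇔ sharp⇒cocktailParty cocktailParty⇒sharp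
  where
  open Distances isD
  open Curvature isD D≤2

  sharp⇒cocktailParty : BonnetMyersSharp D 2 → ∃[ m ] (2 ≤ m × IsCocktailParty G m)
  sharp⇒cocktailParty ((K , sol , 1≤K) , _) =
    nonNeighbourMatching⇒cocktailParty (dist≡2⇒3≤n Duv≡2)
      (ones-solution⇒matching (solution≥1⇒ones-solution Duv≡2 sol 1≤K))

  cocktailParty⇒sharp : ∃[ m ] (2 ≤ m × IsCocktailParty G m) → BonnetMyersSharp D 2
  cocktailParty⇒sharp (m , _ , cp) =
    -- (+ 2) / 2 normalises to 1ℚ
    (_ , ones-solution M , λ _ → QP.≤-refl) , λ _ → solution-has-entry≤1 M u
    where
    M : NonNeighbourMatching G
    M = cocktailParty⇒nonNeighbourMatching m cp
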